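{- Let $G=(V,E)$ be a graph with node weights $w:V\to\mathbb{N}$ such that $w(v)\le W$ for all $v\in V$. Consider independent sets $I_1,I_2,\dots$ and weight functions $w_1,w_2,\dots$ constructed as follows: $w_1=w$; $I_1$ is an independent set of $G$; for each $i\ge1$, $w_{i+1}(u)=\max\{0,\,w_i(u)-\sum_{v\in N^+(u)\cap I_i}w_i(v)\}$ for all $u\in V$; for $i>1$, $I_i$ is an independent set of the subgraph induced by the nodes $v$ with $w_i(v)>0$. Assume that, for every $i\ge1$, $I_i$ is chosen such that $w_i(I_i)\ge\rho\cdot S^*(w_i)$ for some given $\rho\in(0,1)$. Let $\varepsilon\in(0,1]$ and $T\ge\ln(1/\varepsilon)/\rho$, and let $I$ be obtained from $I_1,\dots,I_T$ by starting with $I=\emptyset$ and, for $j=T,T-1,\dots,1$, setting $I:=I\cup(I_j\setminus N^+(I))$. Then $I$ is an independent set with $w(I)\ge(1-\varepsilon)S^*(w)$.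
   Context: $N^+(v)=\{v\}\cup N(v)$, $N^+(S)=\bigcup_{v\in S}N^+(v)$, $f(S)=\sum_{v\in S}f(v)$. For a non-negative weight function $f$ on $V$, $S^*(f)$ is the optimal value of the linear program $\max\sum_{v\in V}f(v)x_v$ subject to $\sum_{u\in N^+(v)}x_u\le1$ for all $v\in V$ and $x_v\ge0$.
   Formalization: The parameters ρ and ε range over the rationals in (0,1) and (0,1] respectively. -}

module Defs where

open import Data.Bool using (Bool; true; false; _∧_; _∨_; not; if_then_else_)
open import Data.Nat as ℕ using (ℕ; zero; suc; _∸_)
open import Data.Fin using (Fin; zero; suc; _≟_)
open import Data.Integer using (+_)
open import Data.Rational as ℚ using (ℚ; 0ℚ; 1ℚ; _/_; _≤_)
open import Data.Product using (Σ; _×_)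
open import Relation.Binary.PropositionalEquality using (_≡_)
open import Relation.Nullary.Decidable using (⌊_⌋)

sumℕ : ∀ {n} → (Fin n → ℕ) → ℕ
sumℕ {zero}  f = 0
sumℕ {suc n} f = f zero ℕ.+ sumℕ (λ i → f (suc i))

sumℚ : ∀ {n} → (Fin n → ℚ) → ℚ
sumℚ {zero}  f = 0ℚ
sumℚ {suc n} f = f zero ℚ.+ sumℚ (λ i → f (suc i))

record Graph (n : ℕ) : Set where
  field
    adj    : Fin n → Fin n → Bool
    adj-sym    : ∀ u v → adj u v ≡ adj v u
    adj-irrefl : ∀ v → adj v v ≡ false

anyFin : ∀ {n} → (Fin n → Bool) → Bool
anyFin {zero}  f = false
anyFin {suc n} f = f zero ∨ anyFin (λ i → f (suc i))

VSet : ℕ → Set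
VSet n = Fin n → Bool

∅ : ∀ {n} → VSet n
∅ _ = false

module _ {n : ℕ} (G : Graph n) where
  open Graph G

  inN⁺ : Fin n → Fin n → Bool
  inN⁺ u v = ⌊ u ≟ v ⌋ ∨ adj u v

  inN⁺Set : VSet n → Fin n → Bool
  inN⁺Set S v = anyFin (λ u → S u ∧ inN⁺ v u)

  Independent : VSet n → Set
  Independent S = ∀ u v → S u ≡ true → S v ≡ true → adj u v ≡ false

  weightOf : (Fin n → ℕ) → VSet n → ℕ
  weightOf f S = sumℕ (λ v → if S v then f v else 0)

  Feasible : (Fin n → ℚ) → Set
  Feasible x = (∀ v → 0ℚ ≤ x v)
             × (∀ v → sumℚ (λ u → if inN⁺ u v then x u else 0ℚ) ≤ 1ℚ)

  objective : (Fin n → ℕ) → (Fin n → ℚ) → ℚ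
  objective f x = sumℚ (λ v → (+ f v / 1) ℚ.* x v)

  -- s = S*(f): s is the optimal value of the LP (attained and maximal)
  IsOptLP : (Fin n → ℕ) → ℚ → Set
  IsOptLP f s = Σ (Fin n → ℚ) (λ x → Feasible x × objective f x ≡ s)
              × (∀ x → Feasible x → objective f x ≤ s)

  nextWeight : (Fin n → ℕ) → VSet n → Fin n → ℕ
  nextWeight wi Ii u = wi u ∸ sumℕ (λ v → if inN⁺ v u ∧ Ii v then wi v else 0)

  addStep : VSet n → VSet n → VSet n
  addStep I J v = I v ∨ (J v ∧ not (inN⁺Set I v))

  combineFrom : (ℕ → VSet n) → ℕ → VSet n → VSet n
  combineFrom Is zero    I = I
  combineFrom Is (suc j) I = combineFrom Is j (addStep I (Is (suc j)))

  combine : (ℕ → VSet n) → ℕ → VSet n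
  combine Is T = combineFrom Is T ∅

expTerm : ℚ → ℕ → ℚ
expTerm x zero    = 1ℚ
expTerm x (suc k) = (expTerm x k ℚ.* x) ℚ.* (+ 1 / suc k)

expPartial : ℚ → ℕ → ℚ
expPartial x zero    = 0ℚ
expPartial x (suc m) = expPartial x m ℚ.+ expTerm x m

-- For ρ > 0, 0 < ε:   T ≥ ln(1/ε)/ρ  ⇔  ρT ≥ ln(1/ε)  ⇔  ε · exp(ρT) ≥ 1,
-- where exp(ρT) = sup_m expPartial (ρT) m (increasing partial sums).
TimeBound : ℚ → ℚ → ℕ → Set
TimeBound ρ ε T =
  ∀ δ → 0ℚ ℚ.< δ → Σ ℕ (λ m → 1ℚ ≤ ε ℚ.* expPartial (ρ ℚ.* (+ T / 1)) m ℚ.+ δ)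

module Submission where

-- Let S*_i be the LP optimum for w_i. Since w_i(u) ≤ w_{i+1}(u) + w_i(N⁺(u) ∩ I_i) and the packing
-- constraints charge every v ∈ I_i at most once, S*_i ≤ w_i(I_i) + S*_{i+1}; with w_i(I_i) ≥ ρ S*_i
-- the residual S*_1 − Σ_{i≤T} w_i(I_i) shrinks by a factor 1 − ρ per round, and (1 − ρ)^T ≤ ε
-- because (1 − ρ)^T e^{ρT} ≤ 1. On the other side, adding I_j ∖ N⁺(I) to the current set I keeps it
-- independent and gains w_j(I_j) − (w_j − w_{j+1})(I), so the backward combination has w-weight at
-- least Σ_{i≤T} w_i(I_i). The LP optima exist by Fourier–Motzkin elimination, and the exponential
-- bound is checked on truncated series via (1 − ρ) e_m(a + ρ) ≤ e_m(a).

open import Data.Bool using (Bool; true; false; if_then_else_; _∧_)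
open import Data.Bool.Properties using (∧-conicalˡ; ∧-conicalʳ)
open import Data.Empty using (⊥-elim)
open import Data.Fin using (Fin; zero; suc; _≟_)
open import Data.Fin.Properties using (suc-injective)
import Data.Integer as ℤ
import Data.Integer.Properties as ℤ
open import Data.List using (List; []; _∷_; _++_; map; foldr; tabulate; cartesianProductWith)
open import Data.List.Membership.Propositional using (_∈_)
open import Data.List.Relation.Unary.All as All using (All; []; _∷_)
import Data.List.Relation.Unary.All.Properties as All
open import Data.Nat as ℕ using (ℕ; zero; suc; z≤n; s≤s)
open import Data.Nat.Coprimality using (1-coprimeTo) renaming (sym to coprime-sym)
import Data.Nat.Properties as ℕ
open import Data.Product using (Σ; _×_; _,_; proj₁; proj₂)
open import Data.Rational as ℚ using (ℚ; 0ℚ; 1ℚ; _+_; _*_; _-_; -_; _≤_; _<_; _/_)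
import Data.Rational.Properties as ℚ
open import Data.Rational.Solver using (module +-*-Solver)
open import Data.Sum using (_⊎_; inj₁; inj₂)
import Data.Vec.Functional as Vec
open import Function using (_∘_)
open import Function.Bundles using (_⇔_; mk⇔; Equivalence)
open import Function.Properties.Equivalence using () renaming (trans to ⇔-trans)
open import Relation.Binary.Bundles using (DecTotalOrder)
open import Relation.Binary.Definitions using (tri<; tri≈; tri>)
open import Relation.Binary.PropositionalEquality
  using (_≡_; _≢_; refl; sym; trans; cong; cong₂; subst; subst₂; module ≡-Reasoning)
open import Relation.Nullary using (yes; no)
open import Relation.Nullary.Decidable using (⌊_⌋)

open import Algebra.Definitions.RawSemiring ℚ.+-*-rawSemiring using (_^_)
open import Algebra.Properties.CommutativeSemigroup ℕ.+-commutativeSemigroup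
  using () renaming (interchange to ℕ-+-interchange)
open import Data.List.Extrema (DecTotalOrder.totalOrder ℚ.≤-decTotalOrder)
  using (min; max; min≤xs; xs≤max; max≤v⁺; v≤min⁺)

open import Defs

open +-*-Solver using (solve; con; _:+_; _:*_; _:-_; :-_; _:=_)

ι : ℕ → ℚ
ι n = ℤ.+ n / 1

private
  ι≡mkℚ : ∀ n → ι n ≡ ℚ.mkℚ (ℤ.+ n) 0 (coprime-sym (1-coprimeTo n))
  ι≡mkℚ n = ℚ.normalize-coprime (coprime-sym (1-coprimeTo n))

ι-homo-+ : ∀ m n → ι (m ℕ.+ n) ≡ ι m + ι n
ι-homo-+ m n rewrite ι≡mkℚ m | ι≡mkℚ n | ℤ.*-identityʳ (ℤ.+ m) | ℤ.*-identityʳ (ℤ.+ n) = refl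

ι-mono-≤ : ∀ {m n} → m ℕ.≤ n → ι m ≤ ι n
ι-mono-≤ {m} {n} m≤n rewrite ι≡mkℚ m | ι≡mkℚ n =
  ℚ.*≤* (subst₂ ℤ._≤_ (sym (ℤ.*-identityʳ (ℤ.+ m))) (sym (ℤ.*-identityʳ (ℤ.+ n))) (ℤ.+≤+ m≤n))

0≤ι : ∀ n → 0ℚ ≤ ι n
0≤ι n = ι-mono-≤ {0} {n} z≤n

0<ι-suc : ∀ n → 0ℚ < ι (suc n)
0<ι-suc n rewrite ι≡mkℚ (suc n) = ℚ.positive⁻¹ _

*-monoˡ-≤-0≤ : ∀ {r p q} → 0ℚ ≤ r → p ≤ q → r * p ≤ r * q
*-monoˡ-≤-0≤ {r} 0≤r = ℚ.*-monoˡ-≤-nonNeg r {{ℚ.nonNegative 0≤r}}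

*-monoʳ-≤-0≤ : ∀ {r p q} → 0ℚ ≤ r → p ≤ q → p * r ≤ q * r
*-monoʳ-≤-0≤ {r} 0≤r = ℚ.*-monoʳ-≤-nonNeg r {{ℚ.nonNegative 0≤r}}

0≤* : ∀ {p q} → 0ℚ ≤ p → 0ℚ ≤ q → 0ℚ ≤ p * q
0≤* {p} 0≤p 0≤q = ℚ.≤-trans (ℚ.≤-reflexive (sym (ℚ.*-zeroʳ p))) (*-monoˡ-≤-0≤ 0≤p 0≤q)

0≤q-p⇒p≤q : ∀ {p q} → 0ℚ ≤ q - p → p ≤ q
0≤q-p⇒p≤q {p} {q} 0≤q-p = begin
  p              ≡⟨ ℚ.+-identityˡ p ⟨
  0ℚ + p         ≤⟨ ℚ.+-monoˡ-≤ p 0≤q-p ⟩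
  q - p + p      ≡⟨ solve 2 (λ p q → q :- p :+ p := q) refl p q ⟩
  q              ∎
  where open ℚ.≤-Reasoning

p≤q⇒0≤q-p : ∀ {p q} → p ≤ q → 0ℚ ≤ q - p
p≤q⇒0≤q-p {p} p≤q = ℚ.≤-trans (ℚ.≤-reflexive (sym (ℚ.+-inverseʳ p))) (ℚ.+-monoˡ-≤ (- p) p≤q)

≤-by-difference : ∀ {p q p′ q′} → p′ ≤ q′ → q - p ≡ q′ - p′ → p ≤ q
≤-by-difference p′≤q′ eq = 0≤q-p⇒p≤q (ℚ.≤-trans (p≤q⇒0≤q-p p′≤q′) (ℚ.≤-reflexive (sym eq)))

≤-by-density : ∀ {p q} → (∀ δ → 0ℚ < δ → p ≤ q + δ) → p ≤ q
≤-by-density {p} {q} p≤q+δ with p ℚ.≤? q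
... | yes p≤q = p≤q
... | no p≰q = ⊥-elim (ℚ.<-irrefl refl (ℚ.<-≤-trans r<p p≤r))
  where
  between = ℚ.<-dense (ℚ.≰⇒> p≰q)
  r = proj₁ between
  q<r = proj₁ (proj₂ between)
  r<p = proj₂ (proj₂ between)
  p≤r : p ≤ r
  p≤r = ℚ.≤-trans (p≤q+δ (r - q) (ℚ.<-respˡ-≡ (ℚ.+-inverseʳ q) (ℚ.+-monoˡ-< (- q) q<r)))
                  (ℚ.≤-reflexive (solve 2 (λ q r → q :+ (r :- q) := r) refl q r))

-- Finite sums

sumℚ-cong : ∀ {n} {f g : Fin n → ℚ} → (∀ i → f i ≡ g i) → sumℚ f ≡ sumℚ g
sumℚ-cong {zero}  f≗g = refl
sumℚ-cong {suc n} f≗g = cong₂ _+_ (f≗g zero) (sumℚ-cong (f≗g ∘ suc))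

sumℚ-mono : ∀ {n} {f g : Fin n → ℚ} → (∀ i → f i ≤ g i) → sumℚ f ≤ sumℚ g
sumℚ-mono {zero}  f≤g = ℚ.≤-refl
sumℚ-mono {suc n} f≤g = ℚ.+-mono-≤ (f≤g zero) (sumℚ-mono (f≤g ∘ suc))

sumℚ-zero : ∀ n → sumℚ {n} (λ _ → 0ℚ) ≡ 0ℚ
sumℚ-zero zero    = refl
sumℚ-zero (suc n) = trans (ℚ.+-identityˡ _) (sumℚ-zero n)

sumℚ-distrib-+ : ∀ {n} (f g : Fin n → ℚ) → sumℚ (λ i → f i + g i) ≡ sumℚ f + sumℚ g
sumℚ-distrib-+ {zero}  f g = refl
sumℚ-distrib-+ {suc n} f g = trans (cong ((f zero + g zero) +_) (sumℚ-distrib-+ (f ∘ suc) (g ∘ suc)))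
  (solve 4 (λ a b c d → (a :+ b) :+ (c :+ d) := (a :+ c) :+ (b :+ d)) refl
     (f zero) (g zero) (sumℚ (f ∘ suc)) (sumℚ (g ∘ suc)))

sumℚ-*ˡ : ∀ {n} c (f : Fin n → ℚ) → sumℚ (λ i → c * f i) ≡ c * sumℚ f
sumℚ-*ˡ {zero}  c f = sym (ℚ.*-zeroʳ c)
sumℚ-*ˡ {suc n} c f = trans (cong (c * f zero +_) (sumℚ-*ˡ c (f ∘ suc)))
  (sym (ℚ.*-distribˡ-+ c (f zero) (sumℚ (f ∘ suc))))

sumℚ-neg : ∀ {n} (f : Fin n → ℚ) → sumℚ (λ i → - f i) ≡ - sumℚ f
sumℚ-neg {zero}  f = refl
sumℚ-neg {suc n} f = trans (cong (- f zero +_) (sumℚ-neg (f ∘ suc))) (sym (ℚ.neg-distrib-+ (f zero) _))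

sumℚ-comm : ∀ {m n} (F : Fin m → Fin n → ℚ) →
            sumℚ (λ i → sumℚ (F i)) ≡ sumℚ (λ j → sumℚ (λ i → F i j))
sumℚ-comm {zero}  {n} F = sym (sumℚ-zero n)
sumℚ-comm {suc m} {n} F = trans (cong (sumℚ (F zero) +_) (sumℚ-comm (F ∘ suc)))
  (sym (sumℚ-distrib-+ (F zero) (λ j → sumℚ (λ i → F (suc i) j))))

0≤sumℚ : ∀ {n} {f : Fin n → ℚ} → (∀ i → 0ℚ ≤ f i) → 0ℚ ≤ sumℚ f
0≤sumℚ {n} 0≤f = ℚ.≤-trans (ℚ.≤-reflexive (sym (sumℚ-zero n))) (sumℚ-mono 0≤f)

term≤sumℚ : ∀ {n} {f : Fin n → ℚ} → (∀ i → 0ℚ ≤ f i) → ∀ i → f i ≤ sumℚ f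
term≤sumℚ {suc n} {f} 0≤f zero = ℚ.≤-trans (ℚ.≤-reflexive (sym (ℚ.+-identityʳ (f zero))))
  (ℚ.+-monoʳ-≤ (f zero) (0≤sumℚ (0≤f ∘ suc)))
term≤sumℚ {suc n} {f} 0≤f (suc i) = ℚ.≤-trans (ℚ.≤-reflexive (sym (ℚ.+-identityˡ (f (suc i)))))
  (ℚ.+-mono-≤ (0≤f zero) (term≤sumℚ (0≤f ∘ suc) i))

sumℚ∘ι≡ι∘sumℕ : ∀ {n} (f : Fin n → ℕ) → sumℚ (ι ∘ f) ≡ ι (sumℕ f)
sumℚ∘ι≡ι∘sumℕ {zero}  f = refl
sumℚ∘ι≡ι∘sumℕ {suc n} f = trans (cong (ι (f zero) +_) (sumℚ∘ι≡ι∘sumℕ (f ∘ suc)))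
  (sym (ι-homo-+ (f zero) (sumℕ (f ∘ suc))))

sumℕ-cong : ∀ {n} {f g : Fin n → ℕ} → (∀ i → f i ≡ g i) → sumℕ f ≡ sumℕ g
sumℕ-cong {zero}  f≗g = refl
sumℕ-cong {suc n} f≗g = cong₂ ℕ._+_ (f≗g zero) (sumℕ-cong (f≗g ∘ suc))

sumℕ-mono : ∀ {n} {f g : Fin n → ℕ} → (∀ i → f i ℕ.≤ g i) → sumℕ f ℕ.≤ sumℕ g
sumℕ-mono {zero}  f≤g = z≤n
sumℕ-mono {suc n} f≤g = ℕ.+-mono-≤ (f≤g zero) (sumℕ-mono (f≤g ∘ suc))

sumℕ-zero : ∀ n → sumℕ {n} (λ _ → 0) ≡ 0
sumℕ-zero zero    = refl
sumℕ-zero (suc n) = sumℕ-zero n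

sumℕ-distrib-+ : ∀ {n} (f g : Fin n → ℕ) → sumℕ (λ i → f i ℕ.+ g i) ≡ sumℕ f ℕ.+ sumℕ g
sumℕ-distrib-+ {zero}  f g = refl
sumℕ-distrib-+ {suc n} f g = trans (cong ((f zero ℕ.+ g zero) ℕ.+_) (sumℕ-distrib-+ (f ∘ suc) (g ∘ suc)))
  (ℕ-+-interchange (f zero) (g zero) (sumℕ (f ∘ suc)) (sumℕ (g ∘ suc)))

sumℕ-comm : ∀ {m n} (F : Fin m → Fin n → ℕ) →
            sumℕ (λ i → sumℕ (F i)) ≡ sumℕ (λ j → sumℕ (λ i → F i j))
sumℕ-comm {zero}  {n} F = sym (sumℕ-zero n)
sumℕ-comm {suc m} {n} F = trans (cong (sumℕ (F zero) ℕ.+_) (sumℕ-comm (F ∘ suc)))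
  (sym (sumℕ-distrib-+ (F zero) (λ j → sumℕ (λ i → F (suc i) j))))

term≤sumℕ : ∀ {n} (f : Fin n → ℕ) i → f i ℕ.≤ sumℕ f
term≤sumℕ f zero    = ℕ.m≤m+n (f zero) _
term≤sumℕ f (suc i) = ℕ.≤-trans (term≤sumℕ (f ∘ suc) i) (ℕ.m≤n+m _ (f zero))

sumℕ-≤-single : ∀ {n} (f : Fin n → ℕ) i → (∀ j → j ≢ i → f j ≡ 0) → sumℕ f ℕ.≤ f i
sumℕ-≤-single {suc n} f zero f≡0 = ℕ.≤-reflexive (begin
  f zero ℕ.+ sumℕ (f ∘ suc)         ≡⟨ cong (f zero ℕ.+_) (sumℕ-cong (λ j → f≡0 (suc j) λ ())) ⟩
  f zero ℕ.+ sumℕ {n} (λ _ → 0)     ≡⟨ cong (f zero ℕ.+_) (sumℕ-zero n) ⟩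
  f zero ℕ.+ 0                       ≡⟨ ℕ.+-identityʳ (f zero) ⟩
  f zero                             ∎)
  where open ≡-Reasoning
sumℕ-≤-single {suc n} f (suc i) f≡0 rewrite f≡0 zero (λ ()) =
  sumℕ-≤-single (f ∘ suc) i (λ j j≢i → f≡0 (suc j) (j≢i ∘ suc-injective))

-- Fourier–Motzkin elimination

All-cartesianProductWith⁺ : ∀ {A B C : Set} {P : C → Set} (f : A → B → C) xs ys →
  All (λ x → All (λ y → P (f x y)) ys) xs → All P (cartesianProductWith f xs ys)
All-cartesianProductWith⁺ f []       ys []         = []
All-cartesianProductWith⁺ f (x ∷ xs) ys (px ∷ pxs) =
  All.++⁺ (All.map⁺ px) (All-cartesianProductWith⁺ f xs ys pxs)

All-cartesianProductWith⁻ : ∀ {A B C : Set} {P : C → Set} (f : A → B → C) xs ys →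
  All P (cartesianProductWith f xs ys) → All (λ x → All (λ y → P (f x y)) ys) xs
All-cartesianProductWith⁻ f []       ys _ = []
All-cartesianProductWith⁻ f (x ∷ xs) ys p =
  All.map⁻ (All.++⁻ˡ (map (f x) ys) p) ∷ All-cartesianProductWith⁻ f xs ys (All.++⁻ʳ (map (f x) ys) p)

separating-point : ∀ (xs ys : List ℚ) → All (λ x → All (x ≤_) ys) xs →
                   Σ ℚ λ z → All (_≤ z) xs × All (z ≤_) ys
separating-point xs ys xs≤ys = z , xs≤max (min 0ℚ ys) xs , All.tabulate z≤
  where
  z = max (min 0ℚ ys) xs
  z≤ : ∀ {y} → y ∈ ys → z ≤ y
  z≤ y∈ys = max≤v⁺ (All.lookup (min≤xs 0ℚ ys) y∈ys) (All.map (λ x≤ys → All.lookup x≤ys y∈ys) xs≤ys)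

recip : (h : ℚ) → 0ℚ < h → ℚ
recip h 0<h = (ℚ.1/ h) {{ℚ.pos⇒nonZero h {{ℚ.positive 0<h}}}}

*-recip : ∀ h (0<h : 0ℚ < h) → h * recip h 0<h ≡ 1ℚ
*-recip h 0<h = ℚ.*-inverseʳ h {{ℚ.pos⇒nonZero h {{ℚ.positive 0<h}}}}

0<recip : ∀ h (0<h : 0ℚ < h) → 0ℚ < recip h 0<h
0<recip h 0<h = ℚ.positive⁻¹ _ {{ℚ.1/pos⇒pos h {{ℚ.positive 0<h}}}}

0<-h : ∀ {h} → h < 0ℚ → 0ℚ < - h
0<-h h<0 = ℚ.neg-antimono-< h<0

record Constraint (m : ℕ) : Set where
  constructor _≤ᶜ_
  field
    coeff : Vec.Vector ℚ m
    bound : ℚ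
open Constraint

dot : ∀ {m} → Vec.Vector ℚ m → Vec.Vector ℚ m → ℚ
dot a x = sumℚ (λ i → a i * x i)

Satisfies : ∀ {m} → Vec.Vector ℚ m → Constraint m → Set
Satisfies x c = dot (coeff c) x ≤ bound c

dot-*ˡ : ∀ {m} r (a x : Vec.Vector ℚ m) → dot (λ i → r * a i) x ≡ r * dot a x
dot-*ˡ r a x = trans (sumℚ-cong (λ i → ℚ.*-assoc r (a i) (x i))) (sumℚ-*ˡ r (λ i → a i * x i))

dot-+ˡ : ∀ {m} (a b x : Vec.Vector ℚ m) → dot (λ i → a i + b i) x ≡ dot a x + dot b x
dot-+ˡ a b x = trans (sumℚ-cong (λ i → ℚ.*-distribʳ-+ (x i) (a i) (b i)))
                    (sumℚ-distrib-+ (λ i → a i * x i) (λ i → b i * x i))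

_+ᶜ_ : ∀ {m} → Constraint m → Constraint m → Constraint m
c +ᶜ d = (λ i → coeff c i + coeff d i) ≤ᶜ (bound c + bound d)

tailᶜ : ∀ {m} → Constraint (suc m) → Constraint m
tailᶜ c = Vec.tail (coeff c) ≤ᶜ bound c

scaleTail : ∀ {m} → ℚ → Constraint (suc m) → Constraint m
scaleTail r c = (λ i → r * coeff c (suc i)) ≤ᶜ (r * bound c)

upperBound lowerBound : ∀ {m} → Constraint m → Vec.Vector ℚ m → ℚ
upperBound c y = bound c - dot (coeff c) y
lowerBound c y = dot (coeff c) y - bound c

+ᶜ-satisfied⇔ : ∀ {m} (l u : Constraint m) y → Satisfies y (l +ᶜ u) ⇔ lowerBound l y ≤ upperBound u y
+ᶜ-satisfied⇔ l u y = mk⇔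
  (λ sat → ≤-by-difference sat (trans (solve 4 gap refl L (bound l) U (bound u))
                                      (cong (λ z → bound l + bound u - z) (sym (dot-+ˡ (coeff l) (coeff u) y)))))
  (λ l≤u → ≤-by-difference l≤u (trans (cong (λ z → bound l + bound u - z) (dot-+ˡ (coeff l) (coeff u) y))
                                      (sym (solve 4 gap refl L (bound l) U (bound u)))))
  where
  L = dot (coeff l) y
  U = dot (coeff u) y
  gap = λ L bl U bu → (bu :- U) :- (L :- bl) := (bl :+ bu) :- (L :+ U)

scaled⇔ : ∀ {m} r σ (c : Constraint (suc m)) x₀ y → 0ℚ < r → r * coeff c zero ≡ σ →
          Satisfies (x₀ Vec.∷ y) c ⇔ σ * x₀ + dot (coeff (scaleTail r c)) y ≤ bound (scaleTail r c)
scaled⇔ r σ c x₀ y 0<r rh≡σ = mk⇔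
  (λ sat → ℚ.≤-trans (ℚ.≤-reflexive (sym scaled)) (*-monoˡ-≤-0≤ (ℚ.<⇒≤ 0<r) sat))
  (λ sat → ℚ.*-cancelˡ-≤-pos r {{ℚ.positive 0<r}} (ℚ.≤-trans (ℚ.≤-reflexive scaled) sat))
  where
  h = coeff c zero
  D = dot (Vec.tail (coeff c)) y
  scaled : r * (h * x₀ + D) ≡ σ * x₀ + dot (coeff (scaleTail r c)) y
  scaled = begin
    r * (h * x₀ + D)          ≡⟨ solve 4 (λ r h x D → r :* (h :* x :+ D) := (r :* h) :* x :+ r :* D) refl r h x₀ D ⟩
    (r * h) * x₀ + r * D      ≡⟨ cong₂ (λ a b → a * x₀ + b) rh≡σ (sym (dot-*ˡ r (Vec.tail (coeff c)) y)) ⟩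
    σ * x₀ + dot (coeff (scaleTail r c)) y ∎
    where open ≡-Reasoning

1*x+d≤b⇔x≤b-d : ∀ x d b → 1ℚ * x + d ≤ b ⇔ x ≤ b - d
1*x+d≤b⇔x≤b-d x d b = mk⇔
  (λ le → ≤-by-difference le (solve 3 (λ x d b → (b :- d) :- x := b :- (con 1ℚ :* x :+ d)) refl x d b))
  (λ le → ≤-by-difference le (solve 3 (λ x d b → b :- (con 1ℚ :* x :+ d) := (b :- d) :- x) refl x d b))

-1*x+d≤b⇔d-b≤x : ∀ x d b → - 1ℚ * x + d ≤ b ⇔ d - b ≤ x
-1*x+d≤b⇔d-b≤x x d b = mk⇔
  (λ le → ≤-by-difference le (solve 3 (λ x d b → x :- (d :- b) := b :- (:- con 1ℚ :* x :+ d)) refl x d b))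
  (λ le → ≤-by-difference le (solve 3 (λ x d b → b :- (:- con 1ℚ :* x :+ d) := x :- (d :- b)) refl x d b))

record Partition (m : ℕ) : Set where
  constructor partition
  field
    uppers lowers others : List (Constraint m)
open Partition

-- A constraint with positive (negative) x₀-coefficient is an upper (lower) bound on x₀; it is scaled
-- so that this coefficient is 1 (−1), which is then dropped.
classify : ∀ {m} → Constraint (suc m) → Partition m → Partition m
classify c (partition U L O) with ℚ.<-cmp 0ℚ (coeff c zero)
... | tri< 0<h _ _ = partition (scaleTail (recip _ 0<h) c ∷ U) L O
... | tri≈ _ _ _   = partition U L (tailᶜ c ∷ O)
... | tri> _ _ h<0 = partition U (scaleTail (recip _ (0<-h h<0)) c ∷ L) O

split : ∀ {m} → List (Constraint (suc m)) → Partition m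
split = foldr classify (partition [] [] [])

Bounds : ∀ {m} → ℚ → Vec.Vector ℚ m → Partition m → Set
Bounds x₀ y P = All (λ u → x₀ ≤ upperBound u y) (uppers P)
              × All (λ l → lowerBound l y ≤ x₀) (lowers P)
              × All (Satisfies y) (others P)

classify⇔ : ∀ {m} (c : Constraint (suc m)) P x₀ y →
            (Satisfies (x₀ Vec.∷ y) c × Bounds x₀ y P) ⇔ Bounds x₀ y (classify c P)
classify⇔ c (partition U L O) x₀ y with ℚ.<-cmp 0ℚ (coeff c zero)
... | tri< 0<h _ _ = mk⇔
  (λ (sat , u , l , o) → Equivalence.to normalised sat ∷ u , l , o)
  (λ { (x₀≤ ∷ u , l , o) → Equivalence.from normalised x₀≤ , u , l , o })
  where
  r = recip _ 0<h
  normalised = ⇔-trans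
    (scaled⇔ r 1ℚ c x₀ y (0<recip _ 0<h) (trans (ℚ.*-comm r _) (*-recip _ 0<h)))
    (1*x+d≤b⇔x≤b-d x₀ _ _)
... | tri≈ _ h≡0 _ = mk⇔
  (λ (sat , u , l , o) → u , l , ℚ.≤-trans (ℚ.≤-reflexive (sym drop-x₀)) sat ∷ o)
  (λ { (u , l , sat ∷ o) → ℚ.≤-trans (ℚ.≤-reflexive drop-x₀) sat , u , l , o })
  where
  drop-x₀ : coeff c zero * x₀ + dot (Vec.tail (coeff c)) y ≡ dot (Vec.tail (coeff c)) y
  drop-x₀ rewrite sym h≡0 = trans (cong (_+ _) (ℚ.*-zeroˡ x₀)) (ℚ.+-identityˡ _)
... | tri> _ _ h<0 = mk⇔
  (λ (sat , u , l , o) → u , Equivalence.to normalised sat ∷ l , o)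
  (λ { (u , ≤x₀ ∷ l , o) → Equivalence.from normalised ≤x₀ , u , l , o })
  where
  r = recip _ (0<-h h<0)
  r*h≡-1 : r * coeff c zero ≡ - 1ℚ
  r*h≡-1 = trans (solve 2 (λ r h → r :* h := :- ((:- h) :* r)) refl r _) (cong -_ (*-recip _ (0<-h h<0)))
  normalised = ⇔-trans
    (scaled⇔ r (- 1ℚ) c x₀ y (0<recip _ (0<-h h<0)) r*h≡-1)
    (-1*x+d≤b⇔d-b≤x x₀ _ _)

split⇔ : ∀ {m} (cs : List (Constraint (suc m))) x₀ y → All (Satisfies (x₀ Vec.∷ y)) cs ⇔ Bounds x₀ y (split cs)
split⇔ []       x₀ y = mk⇔ (λ _ → [] , [] , []) (λ _ → [])
split⇔ (c ∷ cs) x₀ y = mk⇔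
  (λ { (sat ∷ sats) → Equivalence.to (classify⇔ c (split cs) x₀ y) (sat , Equivalence.to (split⇔ cs x₀ y) sats) })
  (λ bounds → let (sat , rest) = Equivalence.from (classify⇔ c (split cs) x₀ y) bounds
              in sat ∷ Equivalence.from (split⇔ cs x₀ y) rest)

eliminate : ∀ {m} → List (Constraint (suc m)) → List (Constraint m)
eliminate cs = others P ++ cartesianProductWith _+ᶜ_ (lowers P) (uppers P)
  where P = split cs

eliminate-sound : ∀ {m} (cs : List (Constraint (suc m))) x₀ y →
                  All (Satisfies (x₀ Vec.∷ y)) cs → All (Satisfies y) (eliminate cs)
eliminate-sound cs x₀ y sats = All.++⁺ others-sat
  (All-cartesianProductWith⁺ _+ᶜ_ (lowers P) (uppers P)
    (All.map (λ {l} l≤x₀ → All.map (λ {u} x₀≤u → Equivalence.from (+ᶜ-satisfied⇔ l u y)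
                                                                  (ℚ.≤-trans l≤x₀ x₀≤u))
                                   x₀≤uppers)
             lowers≤x₀))
  where
  P = split cs
  bounds = Equivalence.to (split⇔ cs x₀ y) sats
  x₀≤uppers = proj₁ bounds
  lowers≤x₀ = proj₁ (proj₂ bounds)
  others-sat = proj₂ (proj₂ bounds)

eliminate-complete : ∀ {m} (cs : List (Constraint (suc m))) y →
                     All (Satisfies y) (eliminate cs) → Σ ℚ λ x₀ → All (Satisfies (x₀ Vec.∷ y)) cs
eliminate-complete cs y sats =
  x₀ , Equivalence.from (split⇔ cs x₀ y)
         (All.map⁻ (proj₂ (proj₂ separated)) , All.map⁻ (proj₁ (proj₂ separated)) , All.++⁻ˡ (others P) sats)
  where
  P = split cs
  lowers≤uppers : All (λ l → All (λ u → lowerBound l y ≤ upperBound u y) (uppers P)) (lowers P)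
  lowers≤uppers = All.map (λ {l} → All.map (λ {u} → Equivalence.to (+ᶜ-satisfied⇔ l u y)))
    (All-cartesianProductWith⁻ _+ᶜ_ (lowers P) (uppers P) (All.++⁻ʳ (others P) sats))
  separated = separating-point (map (λ l → lowerBound l y) (lowers P)) (map (λ u → upperBound u y) (uppers P))
                               (All.map⁺ (All.map All.map⁺ lowers≤uppers))
  x₀ = proj₁ separated

_∷ʳ_ : ∀ {k} → Vec.Vector ℚ k → ℚ → Vec.Vector ℚ (suc k)
_∷ʳ_ {zero}  x t zero    = t
_∷ʳ_ {suc k} x t zero    = x zero
_∷ʳ_ {suc k} x t (suc i) = (Vec.tail x ∷ʳ t) i

eliminateAll : ∀ k → List (Constraint (suc k)) → List (Constraint 1)
eliminateAll zero    cs = cs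
eliminateAll (suc k) cs = eliminateAll k (eliminate cs)

eliminateAll-sound : ∀ k (cs : List (Constraint (suc k))) x t →
                     All (Satisfies (x ∷ʳ t)) cs → All (Satisfies (t Vec.∷ Vec.[])) (eliminateAll k cs)
eliminateAll-sound zero    cs x t sats = sats
eliminateAll-sound (suc k) cs x t sats =
  eliminateAll-sound k (eliminate cs) (Vec.tail x) t (eliminate-sound cs (x zero) (Vec.tail x ∷ʳ t) sats)

eliminateAll-complete : ∀ k (cs : List (Constraint (suc k))) t →
                        All (Satisfies (t Vec.∷ Vec.[])) (eliminateAll k cs) →
                        Σ (Vec.Vector ℚ k) λ x → All (Satisfies (x ∷ʳ t)) cs
eliminateAll-complete zero    cs t sats = Vec.[] , sats
eliminateAll-complete (suc k) cs t sats = (x₀ Vec.∷ x) , proj₂ lifted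
  where
  projected = eliminateAll-complete k (eliminate cs) t sats
  x = proj₁ projected
  lifted = eliminate-complete cs (x ∷ʳ t) (proj₂ projected)
  x₀ = proj₁ lifted

module _ (M : ℚ) where

  -- The largest t ≤ M allowed by a single constraint a t ≤ b that 0 satisfies.
  cap : Constraint 1 → ℚ
  cap c with ℚ.<-cmp 0ℚ (coeff c zero)
  ... | tri< 0<a _ _ = bound c * recip _ 0<a
  ... | tri≈ _ _ _   = M
  ... | tri> _ _ _   = M

  0≤cap : 0ℚ ≤ M → ∀ c → Satisfies (0ℚ Vec.∷ Vec.[]) c → 0ℚ ≤ cap c
  0≤cap 0≤M c sat₀ with ℚ.<-cmp 0ℚ (coeff c zero)
  ... | tri< 0<a _ _ = 0≤* (ℚ.≤-trans (ℚ.≤-reflexive (sym (a·0+0≡0 (coeff c zero)))) sat₀) (ℚ.<⇒≤ (0<recip _ 0<a))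
    where
    a·0+0≡0 : ∀ a → a * 0ℚ + 0ℚ ≡ 0ℚ
    a·0+0≡0 a = trans (ℚ.+-identityʳ _) (ℚ.*-zeroʳ a)
  ... | tri≈ _ _ _   = 0≤M
  ... | tri> _ _ _   = 0≤M

  satisfies⇒≤cap : ∀ {t} c → t ≤ M → Satisfies (t Vec.∷ Vec.[]) c → t ≤ cap c
  satisfies⇒≤cap {t} c t≤M sat with ℚ.<-cmp 0ℚ (coeff c zero)
  ... | tri< 0<a _ _ = begin
    t                          ≡⟨ ℚ.*-identityˡ t ⟨
    1ℚ * t                     ≡⟨ cong (_* t) (*-recip a 0<a) ⟨
    (a * r) * t                ≡⟨ solve 3 (λ a r t → (a :* r) :* t := r :* (a :* t :+ con 0ℚ)) refl a r t ⟩
    r * (a * t + 0ℚ)           ≤⟨ *-monoˡ-≤-0≤ (ℚ.<⇒≤ (0<recip a 0<a)) sat ⟩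
    r * bound c                ≡⟨ ℚ.*-comm r (bound c) ⟩
    bound c * r                ∎
    where
    a = coeff c zero
    r = recip a 0<a
    open ℚ.≤-Reasoning
  ... | tri≈ _ _ _   = t≤M
  ... | tri> _ _ _   = t≤M

  ≤cap⇒satisfies : ∀ {t} c → 0ℚ ≤ t → Satisfies (0ℚ Vec.∷ Vec.[]) c → t ≤ cap c → Satisfies (t Vec.∷ Vec.[]) c
  ≤cap⇒satisfies {t} c 0≤t sat₀ t≤cap with ℚ.<-cmp 0ℚ (coeff c zero)
  ... | tri< 0<a _ _ = begin
    a * t + 0ℚ        ≡⟨ ℚ.+-identityʳ (a * t) ⟩
    a * t             ≤⟨ *-monoˡ-≤-0≤ (ℚ.<⇒≤ 0<a) t≤cap ⟩
    a * (bound c * r) ≡⟨ solve 3 (λ a b r → a :* (b :* r) := b :* (a :* r)) refl a (bound c) r ⟩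
    bound c * (a * r) ≡⟨ cong (bound c *_) (*-recip a 0<a) ⟩
    bound c * 1ℚ      ≡⟨ ℚ.*-identityʳ (bound c) ⟩
    bound c           ∎
    where
    a = coeff c zero
    r = recip a 0<a
    open ℚ.≤-Reasoning
  ... | tri≈ _ 0≡a _ = ℚ.≤-trans (ℚ.≤-reflexive (drop-t 0≡a)) sat₀
    where
    drop-t : ∀ {a} → 0ℚ ≡ a → a * t + 0ℚ ≡ a * 0ℚ + 0ℚ
    drop-t refl = cong (_+ 0ℚ) (trans (ℚ.*-zeroˡ t) (sym (ℚ.*-zeroˡ 0ℚ)))
  ... | tri> _ _ a<0 =
    ℚ.≤-trans (ℚ.+-monoˡ-≤ 0ℚ (ℚ.*-monoˡ-≤-nonPos (coeff c zero) {{ℚ.nonPositive (ℚ.<⇒≤ a<0)}} 0≤t)) sat₀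

bounded-maximum : ∀ (cs : List (Constraint 1)) M → 0ℚ ≤ M → All (Satisfies (0ℚ Vec.∷ Vec.[])) cs →
                  Σ ℚ λ t* → All (Satisfies (t* Vec.∷ Vec.[])) cs
                           × (∀ t → t ≤ M → All (Satisfies (t Vec.∷ Vec.[])) cs → t ≤ t*)
bounded-maximum cs M 0≤M sats₀ =
  t* , All.zipWith (λ {c} (sat₀ , t*≤cap) → ≤cap⇒satisfies M c 0≤t* sat₀ t*≤cap)
                   (sats₀ , All.map⁻ (min≤xs M (map (cap M) cs)))
     , λ t t≤M sats → v≤min⁺ t≤M (All.map⁺ (All.map (λ {c} → satisfies⇒≤cap M c t≤M) sats))
  where
  t* = min M (map (cap M) cs)
  0≤t* : 0ℚ ≤ t*
  0≤t* = v≤min⁺ 0≤M (All.map⁺ (All.map (λ {c} → 0≤cap M 0≤M c) sats₀))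

-- Optima of the packing LP

dot-∷ʳ : ∀ {k} (a x : Vec.Vector ℚ k) α t → dot (a ∷ʳ α) (x ∷ʳ t) ≡ dot a x + α * t
dot-∷ʳ {zero}  a x α t = trans (ℚ.+-identityʳ (α * t)) (sym (ℚ.+-identityˡ (α * t)))
dot-∷ʳ {suc k} a x α t = trans (cong (a zero * x zero +_) (dot-∷ʳ (Vec.tail a) (Vec.tail x) α t))
                               (sym (ℚ.+-assoc (a zero * x zero) _ (α * t)))

dot-indicator : ∀ {k} (P : Fin k → Bool) (x : Vec.Vector ℚ k) →
                dot (λ i → if P i then 1ℚ else 0ℚ) x ≡ sumℚ (λ i → if P i then x i else 0ℚ)
dot-indicator P x = sumℚ-cong (λ i → select (P i) (x i))
  where
  select : ∀ b y → (if b then 1ℚ else 0ℚ) * y ≡ (if b then y else 0ℚ)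
  select true  y = ℚ.*-identityˡ y
  select false y = ℚ.*-zeroˡ y

dot-unit : ∀ {k} c (j : Fin k) (x : Vec.Vector ℚ k) → dot (λ i → if ⌊ i ≟ j ⌋ then c else 0ℚ) x ≡ c * x j
dot-unit {suc k} c zero    x = begin
  c * x zero + sumℚ (λ i → 0ℚ * x (suc i))   ≡⟨ cong (c * x zero +_) (sumℚ-cong (λ i → ℚ.*-zeroˡ (x (suc i)))) ⟩
  c * x zero + sumℚ {k} (λ _ → 0ℚ)          ≡⟨ cong (c * x zero +_) (sumℚ-zero k) ⟩
  c * x zero + 0ℚ                            ≡⟨ ℚ.+-identityʳ _ ⟩
  c * x zero                                 ∎
  where open ≡-Reasoning
dot-unit {suc k} c (suc j) x = begin
  0ℚ * x zero + dot (λ i → if ⌊ suc i ≟ suc j ⌋ then c else 0ℚ) (Vec.tail x)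
    ≡⟨ cong₂ _+_ (ℚ.*-zeroˡ (x zero)) (sumℚ-cong (λ i → cong (λ b → (if b then c else 0ℚ) * x (suc i)) (suc≟suc i j))) ⟩
  0ℚ + dot (λ i → if ⌊ i ≟ j ⌋ then c else 0ℚ) (Vec.tail x)
    ≡⟨ ℚ.+-identityˡ _ ⟩
  dot (λ i → if ⌊ i ≟ j ⌋ then c else 0ℚ) (Vec.tail x)
    ≡⟨ dot-unit c j (Vec.tail x) ⟩
  c * x (suc j) ∎
  where
  open ≡-Reasoning
  suc≟suc : ∀ {k} (i j : Fin k) → ⌊ suc i ≟ suc j ⌋ ≡ ⌊ i ≟ j ⌋
  suc≟suc i j with i ≟ j
  ... | yes _ = refl
  ... | no  _ = refl

module _ {n : ℕ} (G : Graph n) where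

  inN⁺-refl : ∀ u → inN⁺ G u u ≡ true
  inN⁺-refl u with u ≟ u
  ... | yes _   = refl
  ... | no  u≢u = ⊥-elim (u≢u refl)

  -- The LP as a linear system in (x, t) with t ≤ objective f x; t comes last so that eliminating
  -- the first n variables projects onto it.
  objectiveConstraint : (Fin n → ℕ) → Constraint (suc n)
  objectiveConstraint f = ((λ v → - ι (f v)) ∷ʳ 1ℚ) ≤ᶜ 0ℚ

  nonNegConstraint : Fin n → Constraint (suc n)
  nonNegConstraint u = ((λ i → if ⌊ i ≟ u ⌋ then - 1ℚ else 0ℚ) ∷ʳ 0ℚ) ≤ᶜ 0ℚ

  packingConstraint : Fin n → Constraint (suc n)
  packingConstraint v = ((λ u → if inN⁺ G u v then 1ℚ else 0ℚ) ∷ʳ 0ℚ) ≤ᶜ 1ℚ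

  lpSystem : (Fin n → ℕ) → List (Constraint (suc n))
  lpSystem f = objectiveConstraint f ∷ tabulate nonNegConstraint ++ tabulate packingConstraint

  module _ (x : Vec.Vector ℚ n) (t : ℚ) where

    objectiveConstraint-dot : ∀ f → dot (coeff (objectiveConstraint f)) (x ∷ʳ t) ≡ - objective G f x + t
    objectiveConstraint-dot f = begin
      dot ((λ v → - ι (f v)) ∷ʳ 1ℚ) (x ∷ʳ t)   ≡⟨ dot-∷ʳ _ x 1ℚ t ⟩
      dot (λ v → - ι (f v)) x + 1ℚ * t        ≡⟨ cong₂ _+_ (sumℚ-cong (λ v → sym (ℚ.neg-distribˡ-* (ι (f v)) (x v))))
                                                           (ℚ.*-identityˡ t) ⟩
      sumℚ (λ v → - (ι (f v) * x v)) + t      ≡⟨ cong (_+ t) (sumℚ-neg (λ v → ι (f v) * x v)) ⟩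
      - objective G f x + t                    ∎
      where open ≡-Reasoning

    nonNegConstraint-dot : ∀ u → dot (coeff (nonNegConstraint u)) (x ∷ʳ t) ≡ - x u
    nonNegConstraint-dot u = begin
      dot (coeff (nonNegConstraint u)) (x ∷ʳ t)     ≡⟨ dot-∷ʳ _ x 0ℚ t ⟩
      dot (λ i → if ⌊ i ≟ u ⌋ then - 1ℚ else 0ℚ) x + 0ℚ * t ≡⟨ cong₂ _+_ (dot-unit (- 1ℚ) u x) (ℚ.*-zeroˡ t) ⟩
      - 1ℚ * x u + 0ℚ                              ≡⟨ solve 1 (λ y → :- con 1ℚ :* y :+ con 0ℚ := :- y) refl (x u) ⟩
      - x u                                        ∎
      where open ≡-Reasoning

    packingConstraint-dot : ∀ v → dot (coeff (packingConstraint v)) (x ∷ʳ t) ≡ sumℚ (λ u → if inN⁺ G u v then x u else 0ℚ)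
    packingConstraint-dot v = trans (dot-∷ʳ _ x 0ℚ t)
      (trans (cong₂ _+_ (dot-indicator (λ u → inN⁺ G u v) x) (ℚ.*-zeroˡ t)) (ℚ.+-identityʳ _))

    lpSystem⇔ : ∀ f → All (Satisfies (x ∷ʳ t)) (lpSystem f) ⇔ (Feasible G x × t ≤ objective G f x)
    lpSystem⇔ f = mk⇔
      (λ { (obj ∷ rest) →
           ( (λ u → neg≤0⇒0≤ (ℚ.≤-trans (ℚ.≤-reflexive (sym (nonNegConstraint-dot u)))
                                       (All.tabulate⁻ (All.++⁻ˡ (tabulate nonNegConstraint) rest) u)))
           , (λ v → ℚ.≤-trans (ℚ.≤-reflexive (sym (packingConstraint-dot v)))
                             (All.tabulate⁻ (All.++⁻ʳ (tabulate nonNegConstraint) rest) v)) )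
         , ≤-by-difference (ℚ.≤-trans (ℚ.≤-reflexive (sym (objectiveConstraint-dot f))) obj)
                           (solve 2 (λ o t → o :- t := con 0ℚ :- (:- o :+ t)) refl (objective G f x) t) })
      (λ ((0≤x , packed) , t≤obj) →
         ℚ.≤-trans (ℚ.≤-reflexive (objectiveConstraint-dot f))
                   (≤-by-difference t≤obj (solve 2 (λ o t → con 0ℚ :- (:- o :+ t) := o :- t) refl (objective G f x) t))
         ∷ All.++⁺ (All.tabulate⁺ (λ u → ℚ.≤-trans (ℚ.≤-reflexive (nonNegConstraint-dot u)) (ℚ.neg-antimono-≤ (0≤x u))))
                   (All.tabulate⁺ (λ v → ℚ.≤-trans (ℚ.≤-reflexive (packingConstraint-dot v)) (packed v))))
      where
      neg≤0⇒0≤ : ∀ {p} → - p ≤ 0ℚ → 0ℚ ≤ p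
      neg≤0⇒0≤ {p} -p≤0 = ≤-by-difference -p≤0 (solve 1 (λ p → p :- con 0ℚ := con 0ℚ :- (:- p)) refl p)

  feasible⇒≤1 : ∀ {x} → Feasible G x → ∀ u → x u ≤ 1ℚ
  feasible⇒≤1 {x} (0≤x , packed) u = begin
    x u                                         ≡⟨ cong (λ b → if b then x u else 0ℚ) (inN⁺-refl u) ⟨
    (if inN⁺ G u u then x u else 0ℚ)            ≤⟨ term≤sumℚ 0≤term u ⟩
    sumℚ (λ w → if inN⁺ G w u then x w else 0ℚ) ≤⟨ packed u ⟩
    1ℚ                                          ∎
    where
    open ℚ.≤-Reasoning
    0≤term : ∀ w → 0ℚ ≤ (if inN⁺ G w u then x w else 0ℚ)
    0≤term w with inN⁺ G w u
    ... | true  = 0≤x w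
    ... | false = ℚ.≤-refl

  objective≤total : ∀ f {x} → Feasible G x → objective G f x ≤ ι (sumℕ f)
  objective≤total f {x} feasible = begin
    objective G f x    ≤⟨ sumℚ-mono (λ v → *-monoˡ-≤-0≤ (0≤ι (f v)) (feasible⇒≤1 feasible v)) ⟩
    sumℚ (λ v → ι (f v) * 1ℚ) ≡⟨ sumℚ-cong (λ v → ℚ.*-identityʳ (ι (f v))) ⟩
    sumℚ (ι ∘ f)       ≡⟨ sumℚ∘ι≡ι∘sumℕ f ⟩
    ι (sumℕ f)         ∎
    where open ℚ.≤-Reasoning

  zero-feasible : Feasible G (λ _ → 0ℚ)
  zero-feasible = (λ _ → ℚ.≤-refl) , λ v →
    ℚ.≤-trans (ℚ.≤-reflexive (trans (sumℚ-cong (λ u → if-same (inN⁺ G u v))) (sumℚ-zero n))) (ℚ.<⇒≤ (ℚ.positive⁻¹ 1ℚ))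
    where
    if-same : ∀ b → (if b then 0ℚ else 0ℚ) ≡ 0ℚ
    if-same true  = refl
    if-same false = refl

  objective-zero : ∀ f → objective G f (λ _ → 0ℚ) ≡ 0ℚ
  objective-zero f = trans (sumℚ-cong (λ v → ℚ.*-zeroʳ (ι (f v)))) (sumℚ-zero n)

  -- Fourier–Motzkin projects the LP onto t; the optimum is the largest feasible t.
  optimum-exists : ∀ f → Σ ℚ (IsOptLP G f)
  optimum-exists f = t* , (x* , feasible* , ℚ.≤-antisym (upper x* feasible*) t*≤obj) , upper
    where
    projected = eliminateAll n (lpSystem f)
    projected-sound : ∀ x → Feasible G x → All (Satisfies (objective G f x Vec.∷ Vec.[])) projected
    projected-sound x feasible =
      eliminateAll-sound n (lpSystem f) x _ (Equivalence.from (lpSystem⇔ x _ f) (feasible , ℚ.≤-refl))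
    maximum = bounded-maximum projected (ι (sumℕ f)) (0≤ι (sumℕ f))
      (subst (λ t → All (Satisfies (t Vec.∷ Vec.[])) projected) (objective-zero f) (projected-sound _ zero-feasible))
    t* = proj₁ maximum
    upper : ∀ x → Feasible G x → objective G f x ≤ t*
    upper x feasible = proj₂ (proj₂ maximum) _ (objective≤total f feasible) (projected-sound x feasible)
    lifted = eliminateAll-complete n (lpSystem f) t* (proj₁ (proj₂ maximum))
    x* = proj₁ lifted
    feasible* = proj₁ (Equivalence.to (lpSystem⇔ x* t* f) (proj₂ lifted))
    t*≤obj = proj₂ (Equivalence.to (lpSystem⇔ x* t* f) (proj₂ lifted))

  optimum-nonNeg : ∀ f s → IsOptLP G f s → 0ℚ ≤ s
  optimum-nonNeg f s (_ , maximal) = ℚ.≤-trans (ℚ.≤-reflexive (sym (objective-zero f))) (maximal _ zero-feasible)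

  optimum-unique : ∀ f {s s′} → IsOptLP G f s → IsOptLP G f s′ → s ≡ s′
  optimum-unique f ((x , feasible , refl) , maximal) ((x′ , feasible′ , refl) , maximal′) =
    ℚ.≤-antisym (maximal′ x feasible) (maximal x′ feasible′)

-- Truncated exponential series

0≤^ : ∀ {q} → 0ℚ ≤ q → ∀ k → 0ℚ ≤ q ^ k
0≤^ 0≤q zero    = ℚ.<⇒≤ (ℚ.positive⁻¹ 1ℚ)
0≤^ 0≤q (suc k) = 0≤* 0≤q (0≤^ 0≤q k)

^≤1 : ∀ {q} → 0ℚ ≤ q → q ≤ 1ℚ → ∀ k → q ^ k ≤ 1ℚ
^≤1 0≤q q≤1 zero    = ℚ.≤-refl
^≤1 {q} 0≤q q≤1 (suc k) =
  ℚ.≤-trans (*-monoˡ-≤-0≤ 0≤q (^≤1 0≤q q≤1 k)) (ℚ.≤-trans (ℚ.≤-reflexive (ℚ.*-identityʳ q)) q≤1)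

private
  1/suc*suc : ∀ k → (ℤ.+ 1 / suc k) * ι (suc k) ≡ 1ℚ
  1/suc*suc k rewrite ℚ.normalize-coprime {1} {k} (1-coprimeTo (suc k)) | ι≡mkℚ (suc k) =
    ℚ.*-inverseˡ (ℚ.mkℚ (ℤ.+ suc k) 0 (coprime-sym (1-coprimeTo (suc k))))

  0≤1/suc : ∀ k → 0ℚ ≤ ℤ.+ 1 / suc k
  0≤1/suc k = ℚ.nonNegative⁻¹ _ {{ℚ.normalize-nonNeg 1 (suc k)}}

expTerm-suc : ∀ z k → expTerm z (suc k) * ι (suc k) ≡ expTerm z k * z
expTerm-suc z k = trans (ℚ.*-assoc (expTerm z k * z) _ (ι (suc k)))
                        (trans (cong (expTerm z k * z *_) (1/suc*suc k)) (ℚ.*-identityʳ _))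

expTerm-nonNeg : ∀ {z} → 0ℚ ≤ z → ∀ k → 0ℚ ≤ expTerm z k
expTerm-nonNeg 0≤z zero    = ℚ.<⇒≤ (ℚ.positive⁻¹ 1ℚ)
expTerm-nonNeg 0≤z (suc k) = 0≤* (0≤* (expTerm-nonNeg 0≤z k) 0≤z) (0≤1/suc k)

expTerm-mono : ∀ {a b} → 0ℚ ≤ a → a ≤ b → ∀ k → expTerm a k ≤ expTerm b k
expTerm-mono 0≤a a≤b zero    = ℚ.≤-refl
expTerm-mono {a} {b} 0≤a a≤b (suc k) = *-monoʳ-≤-0≤ (0≤1/suc k) (begin
  expTerm a k * a ≤⟨ *-monoʳ-≤-0≤ 0≤a (expTerm-mono 0≤a a≤b k) ⟩
  expTerm b k * a ≤⟨ *-monoˡ-≤-0≤ (expTerm-nonNeg (ℚ.≤-trans 0≤a a≤b) k) a≤b ⟩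
  expTerm b k * b ∎)
  where open ℚ.≤-Reasoning

expTerm-increment : ∀ {a b} → 0ℚ ≤ a → a ≤ b → ∀ k →
                    expTerm b (suc k) - expTerm a (suc k) ≤ (b - a) * expTerm b k
expTerm-increment {a} {b} 0≤a a≤b zero = ℚ.≤-reflexive
  (solve 2 (λ a b → (con 1ℚ :* b) :* con 1ℚ :- (con 1ℚ :* a) :* con 1ℚ := (b :- a) :* con 1ℚ) refl a b)
expTerm-increment {a} {b} 0≤a a≤b (suc k) = ℚ.*-cancelʳ-≤-pos N {{ℚ.positive (0<ι-suc (suc k))}} (begin
  (B₂ - A₂) * N                 ≡⟨ solve 3 (λ B A N → (B :- A) :* N := B :* N :- A :* N) refl B₂ A₂ N ⟩
  B₂ * N - A₂ * N               ≡⟨ cong₂ _-_ (expTerm-suc b (suc k)) (expTerm-suc a (suc k)) ⟩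
  B₁ * b - A₁ * a               ≡⟨ solve 4 (λ a b A B → B :* b :- A :* a := b :* (B :- A) :+ (b :- a) :* A) refl a b A₁ B₁ ⟩
  b * (B₁ - A₁) + d * A₁        ≤⟨ ℚ.+-mono-≤ (*-monoˡ-≤-0≤ 0≤b (expTerm-increment 0≤a a≤b k))
                                               (*-monoˡ-≤-0≤ (p≤q⇒0≤q-p a≤b) (expTerm-mono 0≤a a≤b (suc k))) ⟩
  b * (d * B₀) + d * B₁         ≡⟨ solve 4 (λ b d B₀ B₁ → b :* (d :* B₀) :+ d :* B₁ := d :* (B₀ :* b :+ B₁)) refl b d B₀ B₁ ⟩
  d * (B₀ * b + B₁)             ≡⟨ cong (λ z → d * (z + B₁)) (expTerm-suc b k) ⟨
  d * (B₁ * ι (suc k) + B₁)     ≡⟨ solve 3 (λ d B n → d :* (B :* n :+ B) := (d :* B) :* (con 1ℚ :+ n)) refl d B₁ (ι (suc k)) ⟩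
  (d * B₁) * (1ℚ + ι (suc k))   ≡⟨ cong ((d * B₁) *_) (ι-homo-+ 1 (suc k)) ⟨
  (d * B₁) * N                  ∎)
  where
  open ℚ.≤-Reasoning
  0≤b = ℚ.≤-trans 0≤a a≤b
  d = b - a
  N = ι (suc (suc k))
  A₁ = expTerm a (suc k)
  A₂ = expTerm a (suc (suc k))
  B₀ = expTerm b k
  B₁ = expTerm b (suc k)
  B₂ = expTerm b (suc (suc k))

expPartial-grows : ∀ {z} → 0ℚ ≤ z → ∀ m → expPartial z m ≤ expPartial z (suc m)
expPartial-grows {z} 0≤z m = ℚ.≤-trans (ℚ.≤-reflexive (sym (ℚ.+-identityʳ (expPartial z m))))
                                      (ℚ.+-monoʳ-≤ (expPartial z m) (expTerm-nonNeg 0≤z m))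

expPartial-increment : ∀ {a b} → 0ℚ ≤ a → a ≤ b → ∀ m →
                       expPartial b (suc m) - expPartial a (suc m) ≤ (b - a) * expPartial b m
expPartial-increment {a} {b} 0≤a a≤b zero = ℚ.≤-reflexive
  (solve 1 (λ d → (con 0ℚ :+ con 1ℚ) :- (con 0ℚ :+ con 1ℚ) := d :* con 0ℚ) refl (b - a))
expPartial-increment {a} {b} 0≤a a≤b (suc m) = begin
  (Eb + expTerm b (suc m)) - (Ea + expTerm a (suc m))
    ≡⟨ solve 4 (λ Eb Ea B A → (Eb :+ B) :- (Ea :+ A) := (Eb :- Ea) :+ (B :- A)) refl
               Eb Ea (expTerm b (suc m)) (expTerm a (suc m)) ⟩
  (Eb - Ea) + (expTerm b (suc m) - expTerm a (suc m))
    ≤⟨ ℚ.+-mono-≤ (expPartial-increment 0≤a a≤b m) (expTerm-increment 0≤a a≤b m) ⟩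
  (b - a) * expPartial b m + (b - a) * expTerm b m
    ≡⟨ ℚ.*-distribˡ-+ (b - a) (expPartial b m) (expTerm b m) ⟨
  (b - a) * expPartial b (suc m) ∎
  where
  open ℚ.≤-Reasoning
  Eb = expPartial b (suc m)
  Ea = expPartial a (suc m)

expPartial-shift : ∀ {a ρ} → 0ℚ ≤ a → 0ℚ ≤ ρ → ∀ m → (1ℚ - ρ) * expPartial (a + ρ) m ≤ expPartial a m
expPartial-shift {a} {ρ} 0≤a 0≤ρ zero = ℚ.≤-reflexive (ℚ.*-zeroʳ (1ℚ - ρ))
expPartial-shift {a} {ρ} 0≤a 0≤ρ (suc m) = ≤-by-difference increment≤
  (solve 3 (λ ρ Eb Ea → Ea :- (con 1ℚ :- ρ) :* Eb := ρ :* Eb :- (Eb :- Ea)) refl ρ Eb Ea)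
  where
  Eb = expPartial (a + ρ) (suc m)
  Ea = expPartial a (suc m)
  a≤a+ρ = ℚ.≤-trans (ℚ.≤-reflexive (sym (ℚ.+-identityʳ a))) (ℚ.+-monoʳ-≤ a 0≤ρ)
  increment≤ : Eb - Ea ≤ ρ * Eb
  increment≤ = begin
    Eb - Ea                           ≤⟨ expPartial-increment 0≤a a≤a+ρ m ⟩
    (a + ρ - a) * expPartial (a + ρ) m ≡⟨ cong (_* expPartial (a + ρ) m) (solve 2 (λ a ρ → a :+ ρ :- a := ρ) refl a ρ) ⟩
    ρ * expPartial (a + ρ) m          ≤⟨ *-monoˡ-≤-0≤ 0≤ρ (expPartial-grows (ℚ.≤-trans 0≤a a≤a+ρ) m) ⟩
    ρ * Eb                            ∎
    where open ℚ.≤-Reasoning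

expPartial-0≤1 : ∀ m → expPartial 0ℚ m ≤ 1ℚ
expPartial-0≤1 zero    = ℚ.<⇒≤ (ℚ.positive⁻¹ 1ℚ)
expPartial-0≤1 (suc m) = ℚ.≤-reflexive (expPartial-0≡1 m)
  where
  expPartial-0≡1 : ∀ m → expPartial 0ℚ (suc m) ≡ 1ℚ
  expPartial-0≡1 zero    = refl
  expPartial-0≡1 (suc m) = begin
    expPartial 0ℚ (suc m) + (expTerm 0ℚ m * 0ℚ) * (ℤ.+ 1 / suc m)
      ≡⟨ cong₂ (λ E t → E + t * (ℤ.+ 1 / suc m)) (expPartial-0≡1 m) (ℚ.*-zeroʳ (expTerm 0ℚ m)) ⟩
    1ℚ + 0ℚ * (ℤ.+ 1 / suc m)
      ≡⟨ solve 1 (λ u → con 1ℚ :+ con 0ℚ :* u := con 1ℚ) refl (ℤ.+ 1 / suc m) ⟩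
    1ℚ ∎
    where open ≡-Reasoning

^-*-expPartial≤1 : ∀ {ρ} → 0ℚ ≤ ρ → ρ ≤ 1ℚ → ∀ T m → (1ℚ - ρ) ^ T * expPartial (ρ * ι T) m ≤ 1ℚ
^-*-expPartial≤1 {ρ} 0≤ρ ρ≤1 zero m = ℚ.≤-trans
  (ℚ.≤-reflexive (trans (ℚ.*-identityˡ _) (cong (λ z → expPartial z m) (ℚ.*-zeroʳ ρ)))) (expPartial-0≤1 m)
^-*-expPartial≤1 {ρ} 0≤ρ ρ≤1 (suc T) m = begin
  ((1ℚ - ρ) * q^T) * expPartial (ρ * ι (suc T)) m   ≡⟨ cong (λ z → ((1ℚ - ρ) * q^T) * expPartial z m) ρ[T+1] ⟩
  ((1ℚ - ρ) * q^T) * expPartial (ρ * ι T + ρ) m     ≡⟨ solve 3 (λ q Q E → (q :* Q) :* E := Q :* (q :* E)) refl (1ℚ - ρ) q^T _ ⟩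
  q^T * ((1ℚ - ρ) * expPartial (ρ * ι T + ρ) m)     ≤⟨ *-monoˡ-≤-0≤ (0≤^ (p≤q⇒0≤q-p ρ≤1) T)
                                                         (expPartial-shift (0≤* 0≤ρ (0≤ι T)) 0≤ρ m) ⟩
  q^T * expPartial (ρ * ι T) m                      ≤⟨ ^-*-expPartial≤1 0≤ρ ρ≤1 T m ⟩
  1ℚ                                                ∎
  where
  open ℚ.≤-Reasoning
  q^T = (1ℚ - ρ) ^ T
  ρ[T+1] : ρ * ι (suc T) ≡ ρ * ι T + ρ
  ρ[T+1] = trans (cong (ρ *_) (ι-homo-+ 1 T)) (solve 2 (λ ρ t → ρ :* (con 1ℚ :+ t) := ρ :* t :+ ρ) refl ρ (ι T))

timeBound⇒[1-ρ]^T≤ε : ∀ {ρ ε T} → 0ℚ ≤ ρ → ρ ≤ 1ℚ → 0ℚ ≤ ε → TimeBound ρ ε T → (1ℚ - ρ) ^ T ≤ ε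
timeBound⇒[1-ρ]^T≤ε {ρ} {ε} {T} 0≤ρ ρ≤1 0≤ε timeBound = ≤-by-density λ δ 0<δ →
  let m    = proj₁ (timeBound δ 0<δ)
      E    = expPartial (ρ * ι T) m
      open ℚ.≤-Reasoning
  in begin
    q^T                      ≡⟨ ℚ.*-identityʳ q^T ⟨
    q^T * 1ℚ                 ≤⟨ *-monoˡ-≤-0≤ 0≤q^T (proj₂ (timeBound δ 0<δ)) ⟩
    q^T * (ε * E + δ)        ≡⟨ solve 4 (λ Q ε E δ → Q :* (ε :* E :+ δ) := ε :* (Q :* E) :+ Q :* δ) refl q^T ε E δ ⟩
    ε * (q^T * E) + q^T * δ  ≤⟨ ℚ.+-mono-≤ (*-monoˡ-≤-0≤ 0≤ε (^-*-expPartial≤1 0≤ρ ρ≤1 T m))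
                                           (*-monoʳ-≤-0≤ (ℚ.<⇒≤ 0<δ) (^≤1 0≤q q≤1 T)) ⟩
    ε * 1ℚ + 1ℚ * δ          ≡⟨ solve 2 (λ ε δ → ε :* con 1ℚ :+ con 1ℚ :* δ := ε :+ δ) refl ε δ ⟩
    ε + δ                    ∎
  where
  q^T = (1ℚ - ρ) ^ T
  0≤q = p≤q⇒0≤q-p ρ≤1
  0≤q^T = 0≤^ 0≤q T
  q≤1 : 1ℚ - ρ ≤ 1ℚ
  q≤1 = ≤-by-difference 0≤ρ (solve 1 (λ ρ → con 1ℚ :- (con 1ℚ :- ρ) := ρ :- con 0ℚ) refl ρ)

-- Combining independent sets

anyFin-true : ∀ {k} (p : Fin k → Bool) → anyFin p ≡ true → Σ (Fin k) λ u → p u ≡ true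
anyFin-true {suc k} p any with p zero in p0
... | true  = zero , p0
... | false = let (u , pu) = anyFin-true (p ∘ suc) any in suc u , pu

anyFin-false : ∀ {k} (p : Fin k → Bool) → anyFin p ≡ false → ∀ u → p u ≡ false
anyFin-false {suc k} p none u with p zero in p0
anyFin-false {suc k} p none zero    | false = p0
anyFin-false {suc k} p none (suc u) | false = anyFin-false (p ∘ suc) none u

module _ {n : ℕ} (G : Graph n) where
  open Graph G

  inN⁺-sym : ∀ u v → inN⁺ G u v ≡ inN⁺ G v u
  inN⁺-sym u v with u ≟ v | v ≟ u
  ... | yes _   | yes _   = refl
  ... | yes u≡v | no  v≢u = ⊥-elim (v≢u (sym u≡v))
  ... | no  u≢v | yes v≡u = ⊥-elim (u≢v (sym v≡u))
  ... | no  _   | no  _   = adj-sym u v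

  inN⁺-≢ : ∀ {u v} → u ≢ v → inN⁺ G u v ≡ adj u v
  inN⁺-≢ {u} {v} u≢v with u ≟ v
  ... | yes u≡v = ⊥-elim (u≢v u≡v)
  ... | no  _   = refl

  ¬inN⁺⇒¬adj : ∀ {u v} → inN⁺ G u v ≡ false → adj u v ≡ false
  ¬inN⁺⇒¬adj {u} {v} h with u ≟ v
  ... | no _ = h

  neighbourWeight : (Fin n → ℕ) → VSet n → Fin n → ℕ
  neighbourWeight f J u = sumℕ (λ v → if inN⁺ G v u ∧ J v then f v else 0)

  addStep-cases : ∀ I J v → addStep G I J v ≡ true →
                  I v ≡ true ⊎ (I v ≡ false × J v ≡ true × inN⁺Set G I v ≡ false)
  addStep-cases I J v h with I v | J v | inN⁺Set G I v
  ... | true  | _    | _     = inj₁ refl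
  ... | false | true | false = inj₂ (refl , refl , refl)

  addStep-⊇ : ∀ I J v → I v ≡ true → addStep G I J v ≡ true
  addStep-⊇ I J v Iv rewrite Iv = refl

  outside-N⁺⇒¬adj : ∀ I {u v} → inN⁺Set G I v ≡ false → I u ≡ true → adj v u ≡ false
  outside-N⁺⇒¬adj I {u} {v} v∉N⁺I Iu =
    ¬inN⁺⇒¬adj (subst (λ b → b ∧ inN⁺ G v u ≡ false) Iu (anyFin-false (λ w → I w ∧ inN⁺ G v w) v∉N⁺I u))

  addStep-independent : ∀ I J → Independent G I → Independent G J → Independent G (addStep G I J)
  addStep-independent I J indI indJ u v u∈ v∈ with addStep-cases I J u u∈ | addStep-cases I J v v∈
  ... | inj₁ Iu              | inj₁ Iv              = indI u v Iu Iv
  ... | inj₁ Iu              | inj₂ (_ , _ , v∉N⁺I) = trans (adj-sym u v) (outside-N⁺⇒¬adj I v∉N⁺I Iu)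
  ... | inj₂ (_ , _ , u∉N⁺I) | inj₁ Iv              = outside-N⁺⇒¬adj I u∉N⁺I Iv
  ... | inj₂ (_ , Ju , _)    | inj₂ (_ , Jv , _)    = indJ u v Ju Jv

  -- The dominating vertex is v itself, or a member of I whose closed neighbourhood contains v.
  addStep-dominates : ∀ I J v → J v ≡ true → Σ (Fin n) λ u → addStep G I J u ≡ true × inN⁺ G v u ≡ true
  addStep-dominates I J v Jv with addStep G I J v in v∈
  ... | true  = v , v∈ , inN⁺-refl G v
  ... | false = let (u , hu) = anyFin-true (λ w → I w ∧ inN⁺ G v w) (v∈N⁺I v∈)
                in u , addStep-⊇ I J u (∧-conicalˡ _ _ hu) , ∧-conicalʳ _ _ hu
    where
    v∈N⁺I : addStep G I J v ≡ false → inN⁺Set G I v ≡ true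
    v∈N⁺I v∉ with I v | J v | inN⁺Set G I v
    ... | false | true | true = refl
    v∈N⁺I () | false | true | false

  neighbourWeight-self : ∀ f J u → Independent G J → J u ≡ true → neighbourWeight f J u ℕ.≤ f u
  neighbourWeight-self f J u indJ Ju = ℕ.≤-trans (sumℕ-≤-single _ u only-u) (ℕ.≤-reflexive at-u)
    where
    at-u : (if inN⁺ G u u ∧ J u then f u else 0) ≡ f u
    at-u rewrite inN⁺-refl G u | Ju = refl
    only-u : ∀ v → v ≢ u → (if inN⁺ G v u ∧ J v then f v else 0) ≡ 0
    only-u v v≢u with inN⁺ G v u in vu | J v in Jv
    ... | false | _     = refl
    ... | true  | false = refl
    ... | true  | true  with () ← trans (sym vu) (trans (inN⁺-≢ v≢u) (indJ v u Jv Ju))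

  -- Double counting: each f v with v ∈ J occurs in neighbourWeight f J u for a dominating u ∈ K.
  weight≤dominating : ∀ f (J K : VSet n) → (∀ v → J v ≡ true → Σ (Fin n) λ u → K u ≡ true × inN⁺ G v u ≡ true) →
                      weightOf G f J ℕ.≤ sumℕ (λ u → if K u then neighbourWeight f J u else 0)
  weight≤dominating f J K dominated = ℕ.≤-trans (sumℕ-mono term≤column)
    (ℕ.≤-reflexive (trans (sym (sumℕ-comm F)) (sumℕ-cong {f = λ u → sumℕ (F u)} (λ u → sym (row u (K u))))))
    where
    F : Fin n → Fin n → ℕ
    F u v = if K u then (if inN⁺ G v u ∧ J v then f v else 0) else 0
    row : ∀ u b → (if b then neighbourWeight f J u else 0) ≡ sumℕ (λ v → if b then (if inN⁺ G v u ∧ J v then f v else 0) else 0)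
    row u true  = refl
    row u false = sym (sumℕ-zero n)
    term≤column′ : ∀ v b → J v ≡ b → (if b then f v else 0) ℕ.≤ sumℕ (λ u → F u v)
    term≤column′ v false _  = z≤n
    term≤column′ v true  Jv with dominated v Jv
    ... | u , Ku , vu = ℕ.≤-trans (ℕ.≤-reflexive at-u) (term≤sumℕ (λ u → F u v) u)
      where
      at-u : f v ≡ F u v
      at-u rewrite Ku | vu | Jv = refl
    term≤column : ∀ v → (if J v then f v else 0) ℕ.≤ sumℕ (λ u → F u v)
    term≤column v = term≤column′ v (J v) refl

  weightOf-cong : ∀ {f g} S → (∀ u → f u ≡ g u) → weightOf G f S ≡ weightOf G g S
  weightOf-cong S f≗g = sumℕ-cong (λ u → cong (if S u then_else 0) (f≗g u))

  -- f(J) is covered by the weight removed around the enlarged set, and on I that removed weight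
  -- is exactly f − nextWeight f J.
  addStep-gain : ∀ f J I → Independent G J → (∀ u → I u ≡ true → 0 ℕ.< nextWeight G f J u) →
                 weightOf G f J ℕ.+ weightOf G (nextWeight G f J) I ℕ.≤ weightOf G f (addStep G I J)
  addStep-gain f J I indJ I⊆supp = begin
    weightOf G f J ℕ.+ weightOf G g I
      ≤⟨ ℕ.+-monoˡ-≤ (weightOf G g I) (weight≤dominating f J I′ (addStep-dominates I J)) ⟩
    sumℕ (λ u → if I′ u then R u else 0) ℕ.+ weightOf G g I
      ≡⟨ ℕ.+-comm _ (weightOf G g I) ⟩
    weightOf G g I ℕ.+ sumℕ (λ u → if I′ u then R u else 0)
      ≡⟨ sumℕ-distrib-+ (λ u → if I u then g u else 0) (λ u → if I′ u then R u else 0) ⟨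
    sumℕ (λ u → (if I u then g u else 0) ℕ.+ (if I′ u then R u else 0))
      ≤⟨ sumℕ-mono (λ u → pointwise u (I′ u) refl) ⟩
    weightOf G f I′ ∎
    where
    open ℕ.≤-Reasoning
    g = nextWeight G f J
    R = neighbourWeight f J
    I′ = addStep G I J
    pointwise : ∀ u b → I′ u ≡ b → (if I u then g u else 0) ℕ.+ (if b then R u else 0) ℕ.≤ (if b then f u else 0)
    pointwise u true u∈I′ with addStep-cases I J u u∈I′
    ... | inj₁ Iu rewrite Iu = ℕ.≤-reflexive (ℕ.m∸n+n≡m (ℕ.<⇒≤ R<f))
      where
      R<f : R u ℕ.< f u
      R<f = ℕ.m∸n≢0⇒n<m (λ g≡0 → ℕ.<-irrefl (sym g≡0) (I⊆supp u Iu))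
    ... | inj₂ (¬Iu , Ju , _) rewrite ¬Iu = neighbourWeight-self f J u indJ Ju
    pointwise u false u∉I′ with I u
    ... | false = z≤n
    pointwise u false () | true

  -- Exchange the two sums; the packing constraint at each v ∈ J bounds its inner sum by 1.
  neighbourWeight-mass : ∀ f J {x} → Feasible G x → sumℚ (λ u → ι (neighbourWeight f J u) * x u) ≤ ι (weightOf G f J)
  neighbourWeight-mass f J {x} (_ , packed) = begin
    sumℚ (λ u → ι (neighbourWeight f J u) * x u)        ≡⟨ sumℚ-cong (λ u → expand u) ⟩
    sumℚ (λ u → sumℚ (λ v → ι (h v u) * x u))          ≡⟨ sumℚ-comm (λ u v → ι (h v u) * x u) ⟩
    sumℚ (λ v → sumℚ (λ u → ι (h v u) * x u))          ≡⟨ sumℚ-cong (λ v → trans (sumℚ-cong (λ u → factor v u (inN⁺ G u v) refl))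
                                                                                 (sumℚ-*ˡ (ι (fJ v)) (λ u → if inN⁺ G u v then x u else 0ℚ))) ⟩
    sumℚ (λ v → ι (fJ v) * sumℚ (λ u → if inN⁺ G u v then x u else 0ℚ))
                                                       ≤⟨ sumℚ-mono (λ v → *-monoˡ-≤-0≤ (0≤ι (fJ v)) (packed v)) ⟩
    sumℚ (λ v → ι (fJ v) * 1ℚ)                         ≡⟨ sumℚ-cong (λ v → ℚ.*-identityʳ (ι (fJ v))) ⟩
    sumℚ (ι ∘ fJ)                                      ≡⟨ sumℚ∘ι≡ι∘sumℕ fJ ⟩
    ι (weightOf G f J)                                 ∎
    where
    open ℚ.≤-Reasoning
    h : Fin n → Fin n → ℕ
    h v u = if inN⁺ G v u ∧ J v then f v else 0
    fJ : Fin n → ℕ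
    fJ v = if J v then f v else 0
    expand : ∀ u → ι (neighbourWeight f J u) * x u ≡ sumℚ (λ v → ι (h v u) * x u)
    expand u = begin-equality
      ι (neighbourWeight f J u) * x u      ≡⟨ cong (_* x u) (sumℚ∘ι≡ι∘sumℕ (λ v → h v u)) ⟨
      sumℚ (λ v → ι (h v u)) * x u         ≡⟨ ℚ.*-comm (sumℚ (λ v → ι (h v u))) (x u) ⟩
      x u * sumℚ (λ v → ι (h v u))         ≡⟨ sumℚ-*ˡ (x u) (λ v → ι (h v u)) ⟨
      sumℚ (λ v → x u * ι (h v u))         ≡⟨ sumℚ-cong (λ v → ℚ.*-comm (x u) (ι (h v u))) ⟩
      sumℚ (λ v → ι (h v u) * x u)         ∎
    factor : ∀ v u b → inN⁺ G u v ≡ b → ι (h v u) * x u ≡ ι (fJ v) * (if b then x u else 0ℚ)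
    factor v u true  uv rewrite inN⁺-sym v u | uv = refl
    factor v u false uv rewrite inN⁺-sym v u | uv = trans (ℚ.*-zeroˡ (x u)) (sym (ℚ.*-zeroʳ (ι (fJ v))))

  objective-nextWeight : ∀ f g J {x} → (∀ u → g u ≡ nextWeight G f J u) → Feasible G x →
                         objective G f x ≤ ι (weightOf G f J) + objective G g x
  objective-nextWeight f g J {x} g≗next feasible = begin
    objective G f x                                              ≤⟨ sumℚ-mono split-weight ⟩
    sumℚ (λ u → ι (g u) * x u + ι (R u) * x u)                   ≡⟨ sumℚ-distrib-+ (λ u → ι (g u) * x u) (λ u → ι (R u) * x u) ⟩
    objective G g x + sumℚ (λ u → ι (R u) * x u)                 ≤⟨ ℚ.+-monoʳ-≤ (objective G g x) (neighbourWeight-mass f J feasible) ⟩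
    objective G g x + ι (weightOf G f J)                         ≡⟨ ℚ.+-comm (objective G g x) (ι (weightOf G f J)) ⟩
    ι (weightOf G f J) + objective G g x                         ∎
    where
    open ℚ.≤-Reasoning
    R = neighbourWeight f J
    split-weight : ∀ u → ι (f u) * x u ≤ ι (g u) * x u + ι (R u) * x u
    split-weight u = ℚ.≤-trans (*-monoʳ-≤-0≤ (proj₁ feasible u) (ι-mono-≤ f≤g+R))
                               (ℚ.≤-reflexive (trans (cong (_* x u) (ι-homo-+ (g u) (R u)))
                                                     (ℚ.*-distribʳ-+ (x u) (ι (g u)) (ι (R u)))))
      where
      f≤g+R : f u ℕ.≤ g u ℕ.+ R u
      f≤g+R = ℕ.≤-trans (ℕ.m≤n+m∸n (f u) (R u))
                        (ℕ.≤-reflexive (trans (ℕ.+-comm (R u) _) (cong (ℕ._+ R u) (sym (g≗next u)))))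

  S*-nextWeight : ∀ f g J {s s′} → (∀ u → g u ≡ nextWeight G f J u) → IsOptLP G f s → IsOptLP G g s′ →
                  s ≤ ι (weightOf G f J) + s′
  S*-nextWeight f g J g≗next ((x , feasible , refl) , _) (_ , maximal′) =
    ℚ.≤-trans (objective-nextWeight f g J g≗next feasible) (ℚ.+-monoʳ-≤ (ι (weightOf G f J)) (maximal′ x feasible))

-- The rounds of the algorithm

prefixSum : (ℕ → ℕ) → ℕ → ℕ
prefixSum a zero    = 0
prefixSum a (suc k) = prefixSum a k ℕ.+ a k

module BackwardCombination {n : ℕ} (G : Graph n) (ws : ℕ → Fin n → ℕ) (Is : ℕ → VSet n)
  (independent₁ : Independent G (Is 1))
  (next : ∀ i → 1 ℕ.≤ i → ∀ u → ws (suc i) u ≡ nextWeight G (ws i) (Is i) u)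
  (later : ∀ i → 1 ℕ.< i → Independent G (Is i) × (∀ v → Is i v ≡ true → 0 ℕ.< ws i v)) where

  independent : ∀ i → 1 ℕ.≤ i → Independent G (Is i)
  independent (suc zero)    _ = independent₁
  independent (suc (suc i)) _ = proj₁ (later (suc (suc i)) (s≤s (s≤s z≤n)))

  gain : ℕ → ℕ
  gain k = weightOf G (ws (suc k)) (Is (suc k))

  -- combineFrom G Is j I adds I_j, …, I_1 to I. The support condition is only needed while a step
  -- remains: at j = 0 it would demand I_1 ⊆ supp w_1, which is not assumed.
  combineFrom-bound : ∀ j I → Independent G I → (1 ℕ.≤ j → ∀ u → I u ≡ true → 0 ℕ.< ws (suc j) u) →
                      Independent G (combineFrom G Is j I)
                      × prefixSum gain j ℕ.+ weightOf G (ws (suc j)) I ℕ.≤ weightOf G (ws 1) (combineFrom G Is j I)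
  combineFrom-bound zero    I indI _       = indI , ℕ.≤-refl
  combineFrom-bound (suc j) I indI I⊆supp = proj₁ rest , (begin
    prefixSum gain j ℕ.+ gain j ℕ.+ weightOf G (ws (suc (suc j))) I     ≡⟨ ℕ.+-assoc (prefixSum gain j) (gain j) _ ⟩
    prefixSum gain j ℕ.+ (gain j ℕ.+ weightOf G (ws (suc (suc j))) I)   ≤⟨ ℕ.+-monoʳ-≤ (prefixSum gain j) step ⟩
    prefixSum gain j ℕ.+ weightOf G (ws (suc j)) I′                     ≤⟨ proj₂ rest ⟩
    weightOf G (ws 1) (combineFrom G Is j I′)                           ∎)
    where
    open ℕ.≤-Reasoning
    f = ws (suc j)
    J = Is (suc j)
    I′ = addStep G I J
    next-f = next (suc j) (s≤s z≤n)
    step : gain j ℕ.+ weightOf G (ws (suc (suc j))) I ℕ.≤ weightOf G f I′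
    step = ℕ.≤-trans (ℕ.≤-reflexive (cong (gain j ℕ.+_) (weightOf-cong G I next-f)))
      (addStep-gain G f J I (independent (suc j) (s≤s z≤n))
                    (λ u Iu → subst (0 ℕ.<_) (next-f u) (I⊆supp (s≤s z≤n) u Iu)))
    I′⊆supp : 1 ℕ.≤ j → ∀ u → I′ u ≡ true → 0 ℕ.< f u
    I′⊆supp 1≤j u u∈I′ with addStep-cases G I J u u∈I′
    ... | inj₁ Iu = ℕ.<-≤-trans (I⊆supp (s≤s z≤n) u Iu)
                                (ℕ.≤-trans (ℕ.≤-reflexive (next-f u)) (ℕ.m∸n≤m (f u) (neighbourWeight G f J u)))
    ... | inj₂ (_ , Ju , _) = proj₂ (later (suc j) (s≤s 1≤j)) u Ju
    rest = combineFrom-bound j I′ (addStep-independent G I J indI (independent (suc j) (s≤s z≤n))) I′⊆supp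

  combine-bound : ∀ T → Independent G (combine G Is T) × prefixSum gain T ℕ.≤ weightOf G (ws 1) (combine G Is T)
  combine-bound T = proj₁ fromEmpty , ℕ.≤-trans (ℕ.m≤m+n (prefixSum gain T) _) (proj₂ fromEmpty)
    where fromEmpty = combineFrom-bound T ∅ (λ _ _ ()) (λ _ _ ())

module _ {ρ : ℚ} (s : ℕ → ℚ) (a : ℕ → ℕ)
  (s≤a+s : ∀ k → s k ≤ ι (a k) + s (suc k)) (ρs≤a : ∀ k → ρ * s k ≤ ι (a k)) where

  private
    residual-suc : ∀ T → s 0 - ι (prefixSum a (suc T)) ≡ (s 0 - ι (prefixSum a T)) - ι (a T)
    residual-suc T = trans (cong (λ P → s 0 - P) (ι-homo-+ (prefixSum a T) (a T)))
      (solve 3 (λ s A a → s :- (A :+ a) := (s :- A) :- a) refl (s 0) (ι (prefixSum a T)) (ι (a T)))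

  residual≤s : ∀ T → s 0 - ι (prefixSum a T) ≤ s T
  residual≤s zero    = ℚ.≤-reflexive (solve 1 (λ s → s :- con 0ℚ := s) refl (s 0))
  residual≤s (suc T) = begin
    s 0 - ι (prefixSum a (suc T))       ≡⟨ residual-suc T ⟩
    (s 0 - ι (prefixSum a T)) - ι (a T) ≤⟨ ℚ.+-monoˡ-≤ (- ι (a T)) (residual≤s T) ⟩
    s T - ι (a T)                       ≤⟨ ≤-by-difference (s≤a+s T)
                                             (solve 3 (λ s a t → t :- (s :- a) := (a :+ t) :- s) refl (s T) (ι (a T)) (s (suc T))) ⟩
    s (suc T)                           ∎
    where open ℚ.≤-Reasoning

  residual≤geometric : 0ℚ ≤ ρ → ρ ≤ 1ℚ → ∀ T → s 0 - ι (prefixSum a T) ≤ (1ℚ - ρ) ^ T * s 0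
  residual≤geometric 0≤ρ ρ≤1 zero    = ℚ.≤-reflexive (solve 1 (λ s → s :- con 0ℚ := con 1ℚ :* s) refl (s 0))
  residual≤geometric 0≤ρ ρ≤1 (suc T) = begin
    s 0 - ι (prefixSum a (suc T))  ≡⟨ residual-suc T ⟩
    D - ι (a T)                    ≤⟨ ℚ.+-monoʳ-≤ D (ℚ.neg-antimono-≤ ρD≤a) ⟩
    D - ρ * D                      ≡⟨ solve 2 (λ ρ D → D :- ρ :* D := (con 1ℚ :- ρ) :* D) refl ρ D ⟩
    (1ℚ - ρ) * D                   ≤⟨ *-monoˡ-≤-0≤ (p≤q⇒0≤q-p ρ≤1) (residual≤geometric 0≤ρ ρ≤1 T) ⟩
    (1ℚ - ρ) * ((1ℚ - ρ) ^ T * s 0) ≡⟨ ℚ.*-assoc (1ℚ - ρ) ((1ℚ - ρ) ^ T) (s 0) ⟨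
    (1ℚ - ρ) ^ suc T * s 0          ∎
    where
    open ℚ.≤-Reasoning
    D = s 0 - ι (prefixSum a T)
    ρD≤a : ρ * D ≤ ι (a T)
    ρD≤a = ℚ.≤-trans (*-monoˡ-≤-0≤ 0≤ρ (residual≤s T)) (ρs≤a T)

-- Opened only here: a prefix +_ in scope makes sections of ℚ's _+_ ambiguous.
open import Data.Integer using (+_)

-- The bound W on the weights only matters for the running time in the paper.
lemma4p6 : ∀ {n} (G : Graph n) (w : Fin n → ℕ) (W : ℕ) → (∀ v → w v ℕ.≤ W)
    → (ws : ℕ → Fin n → ℕ) (Is : ℕ → VSet n)
    → ws 1 ≡ w
    → Independent G (Is 1)
    → (∀ i → 1 ℕ.≤ i → ∀ u → ws (suc i) u ≡ nextWeight G (ws i) (Is i) u)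
    → (∀ i → 1 ℕ.< i → Independent G (Is i) × (∀ v → Is i v ≡ true → 0 ℕ.< ws i v))
    → (ρ : ℚ) → 0ℚ ℚ.< ρ → ρ ℚ.< 1ℚ
    → (∀ i → 1 ℕ.≤ i → ∀ s → IsOptLP G (ws i) s
         → ρ ℚ.* s ℚ.≤ (+ weightOf G (ws i) (Is i) / 1))
    → (ε : ℚ) → 0ℚ ℚ.< ε → ε ℚ.≤ 1ℚ
    → (T : ℕ) → TimeBound ρ ε T
    → Independent G (combine G Is T)
      × (∀ s → IsOptLP G w s
           → (1ℚ ℚ.- ε) ℚ.* s ℚ.≤ (+ weightOf G w (combine G Is T) / 1))
lemma4p6 G _ _ _ ws Is refl indep₁ next later ρ 0<ρ ρ<1 approx ε 0<ε ε≤1 T timeBound =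
  proj₁ greedy , λ s opt → begin
    (1ℚ - ε) * s                       ≡⟨ cong ((1ℚ - ε) *_) (optimum-unique G (ws 1) opt (S*-optimal 0)) ⟩
    (1ℚ - ε) * S* 0                    ≤⟨ ≤-by-difference residual≤εS*
                                            (solve 3 (λ ε S A → A :- (con 1ℚ :- ε) :* S := ε :* S :- (S :- A)) refl ε (S* 0) A) ⟩
    A                                  ≤⟨ ι-mono-≤ (proj₂ greedy) ⟩
    ι (weightOf G (ws 1) (combine G Is T)) ∎
  where
  open ℚ.≤-Reasoning
  open BackwardCombination G ws Is indep₁ next later
  greedy = combine-bound T
  A = ι (prefixSum gain T)
  S* : ℕ → ℚ
  S* k = proj₁ (optimum-exists G (ws (suc k)))
  S*-optimal : ∀ k → IsOptLP G (ws (suc k)) (S* k)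
  S*-optimal k = proj₂ (optimum-exists G (ws (suc k)))
  0≤ρ = ℚ.<⇒≤ 0<ρ
  residual≤εS* : S* 0 - A ≤ ε * S* 0
  residual≤εS* = ℚ.≤-trans
    (residual≤geometric S* gain
       (λ k → S*-nextWeight G (ws (suc k)) (ws (suc (suc k))) (Is (suc k)) (next (suc k) (s≤s z≤n))
                            (S*-optimal k) (S*-optimal (suc k)))
       (λ k → approx (suc k) (s≤s z≤n) (S* k) (S*-optimal k))
       0≤ρ (ℚ.<⇒≤ ρ<1) T)
    (*-monoʳ-≤-0≤ (optimum-nonNeg G (ws 1) (S* 0) (S*-optimal 0))
                  (timeBound⇒[1-ρ]^T≤ε {T = T} 0≤ρ (ℚ.<⇒≤ ρ<1) (ℚ.<⇒≤ 0<ε) timeBound))
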